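{- Let $q=p^{m_0}$, $A=\mathbb{F}_q[\theta]$, let $\beta\ge 0$ and $j\ge 0$ be integers, and regard $t$ as an indeterminate. Define $$z(\chi_t^\beta,x,-j):=\sum_{e=0}^\infty x^{ -e}\Bigl(\sum_{a\in A_+(e)}\chi_t(a)^\beta a^j\Bigr).$$ Then $z(\chi_t^\beta,x,-j)\in A[t][x^{ -1}]$, i.e. it is a polynomial in $x^{ -1}$ with coefficients in $A[t]$.
   Context: $A_+(e)$ denotes the set of monic polynomials in $A$ of degree $e$. For $a=a(\theta)\in A$, $\chi_t(a):=a(t)$, the polynomial obtained by substituting $t$ for $\theta$. (In terms of the Pellarin $L$-series $L(\chi_t^\beta,s)=\sum_{a\in A_+}\chi_t(a)^\beta a^{ -s}$ on $\mathbb{S}_\infty=\mathbb{C}_\infty^\ast\times\mathbb{Z}_p$, with $a^{(x,y)}=x^{\deg a}(\theta^{ -\deg a}a)^y$, one has $z(\chi_t^\beta,x,-j)=L(\chi_t^\beta,(x\theta^{ -j},-j))$.) -}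

module Defs where

open import Level using (Level; _⊔_)
open import Algebra.Bundles using (CommutativeRing)
open import Data.Nat as ℕ using (ℕ; zero; suc; _≤_; _∸_)
open import Data.Nat.Primality using (Prime)
open import Data.Fin using (Fin; toℕ)
open import Data.Vec as Vec using (Vec; []; _∷_)
open import Data.List as List using (List; []; _∷_; length; concatMap; map; foldr)
open import Data.List.Relation.Unary.Any using (Any)
open import Data.List.Relation.Unary.AllPairs using (AllPairs)
open import Data.Product using (Σ; _×_; ∃)
open import Relation.Nullary using (¬_)
open import Relation.Binary.PropositionalEquality using (_≡_)

record FiniteField (c ℓ : Level) (p m0 : ℕ) : Set (Level.suc (c ⊔ ℓ)) where
  field
    baseRing  : CommutativeRing c ℓ
  open CommutativeRing baseRing public
  field
    elems     : List Carrier
    complete  : ∀ x → Any (x ≈_) elems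
    unique    : AllPairs (λ x y → ¬ (x ≈ y)) elems
    1≉0       : ¬ (1# ≈ 0#)
    inverse   : ∀ x → ¬ (x ≈ 0#) → ∃ λ y → (x * y) ≈ 1#
    p-prime   : Prime p
    m0-pos    : 1 ≤ m0
    card      : length elems ≡ p ℕ.^ m0

  -- Elements of F[θ, t] are represented by their coefficient functions:
  -- f i k is the coefficient of θ^i t^k.  (All objects built below have
  -- finite support.)
  Poly2 : Set c
  Poly2 = ℕ → ℕ → Carrier

  IsZero : Poly2 → Set ℓ
  IsZero f = ∀ i k → f i k ≈ 0#

  zeroP : Poly2
  zeroP _ _ = 0#

  oneP : Poly2
  oneP zero zero = 1#
  oneP _    _    = 0#

  _+P_ : Poly2 → Poly2 → Poly2
  (f +P g) i k = f i k + g i k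

  sumTo : ℕ → (ℕ → Carrier) → Carrier
  sumTo zero    h = h 0
  sumTo (suc n) h = sumTo n h + h (suc n)

  _*P_ : Poly2 → Poly2 → Poly2
  (f *P g) i k = sumTo i λ a → sumTo k λ b → f a b * g (i ∸ a) (k ∸ b)

  _^P_ : Poly2 → ℕ → Poly2
  f ^P zero  = oneP
  f ^P suc n = f *P (f ^P n)

  allVecs : (e : ℕ) → List (Vec Carrier e)
  allVecs zero    = [] ∷ []
  allVecs (suc e) = concatMap (λ x → map (x ∷_) (allVecs e)) elems

  -- Coefficients of the monic polynomial c_0 + c_1 θ + … + c_{e-1} θ^{e-1} + θ^e.
  monicCoeff : {e : ℕ} → Vec Carrier e → ℕ → Carrier
  monicCoeff []       zero    = 1#
  monicCoeff []       (suc i) = 0#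
  monicCoeff (c ∷ cs) zero    = c
  monicCoeff (c ∷ cs) (suc i) = monicCoeff cs i

  inθ : {e : ℕ} → Vec Carrier e → Poly2
  inθ cs i zero    = monicCoeff cs i
  inθ cs i (suc k) = 0#

  -- χ_t(a) = a(t) ∈ F[t] ⊂ A[t]
  χt : {e : ℕ} → Vec Carrier e → Poly2
  χt cs zero    k = monicCoeff cs k
  χt cs (suc i) k = 0#

  S : (β j e : ℕ) → Poly2
  S β j e = foldr (λ cs acc → ((χt cs ^P β) *P (inθ cs ^P j)) +P acc) zeroP (allVecs e)

module Submission where

-- The theorem says that for e > β + j the power sum
--   S(e) = Σ_{a ∈ A_+(e)} χ_t(a)^β a^j  ∈  F[θ, t]
-- vanishes.  A monic polynomial of degree e is its coefficient vector
-- v ∈ F^e, and every coefficient of χ_t(a)^β a^j is a polynomial function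
-- of v of total degree ≤ β + j (each coefficient of a or of χ_t(a) is a
-- constant or one coordinate of v).  So the theorem follows from the
-- classical vanishing lemma:
--   over a finite commutative ring F, Σ_{v ∈ F^e} f(v) = 0 whenever f is a
--   polynomial function of degree d < e.

open import Defs
open import Level using (Level; _⊔_)
open import Algebra.Bundles using (CommutativeRing)
import Algebra.Properties.CommutativeSemigroup as CommutativeSemigroupProperties
import Algebra.Properties.Group as GroupProperties
open import Data.Nat as ℕ using (ℕ; zero; suc; _≥_; _≤_; _<_; _∸_; z≤n; s≤s)
import Data.Nat.Properties as ℕP
open import Data.Fin using (Fin; zero; suc)
open import Data.Vec using (Vec; []; _∷_; lookup; tail)
open import Data.List using (List; []; _∷_; map; _++_; concatMap; foldr)
open import Data.List.Relation.Unary.Any using (here; there; _─_)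
open import Data.List.Relation.Unary.All.Properties using (─⁺)
open import Data.List.Relation.Unary.AllPairs using (_∷_)
import Data.List.Membership.Setoid as SetoidMembership
import Data.List.Membership.Setoid.Properties as SetoidMembershipProperties
import Data.List.Relation.Unary.Unique.Setoid as SetoidUnique
import Data.List.Relation.Unary.Unique.Setoid.Properties as SetoidUniqueProperties
open import Data.Product using (∃; _,_)
open import Data.Empty using (⊥-elim)
open import Relation.Nullary using (¬_)
import Relation.Binary.PropositionalEquality as ≡
import Relation.Binary.Reasoning.Setoid as SetoidReasoning

module ListSums {c ℓ : Level} (R : CommutativeRing c ℓ) where
  open CommutativeRing R
  open CommutativeSemigroupProperties +-commutativeSemigroup using (interchange)

  ∑ : ∀ {a} {A : Set a} → List A → (A → Carrier) → Carrier
  ∑ []       f = 0#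
  ∑ (x ∷ xs) f = f x + ∑ xs f

  ∑-cong : ∀ {a} {A : Set a} (xs : List A) {f g : A → Carrier} →
           (∀ x → f x ≈ g x) → ∑ xs f ≈ ∑ xs g
  ∑-cong []       f≈g = refl
  ∑-cong (x ∷ xs) f≈g = +-cong (f≈g x) (∑-cong xs f≈g)

  ∑-zero : ∀ {a} {A : Set a} (xs : List A) {f : A → Carrier} → (∀ x → f x ≈ 0#) → ∑ xs f ≈ 0#
  ∑-zero []       f≈0 = refl
  ∑-zero (x ∷ xs) f≈0 = trans (+-cong (f≈0 x) (∑-zero xs f≈0)) (+-identityˡ 0#)

  ∑-+ : ∀ {a} {A : Set a} (xs : List A) (f g : A → Carrier) →
        ∑ xs (λ x → f x + g x) ≈ ∑ xs f + ∑ xs g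
  ∑-+ []       f g = sym (+-identityˡ 0#)
  ∑-+ (x ∷ xs) f g = trans (+-congˡ (∑-+ xs f g)) (interchange (f x) (g x) (∑ xs f) (∑ xs g))

  ∑-*ˡ : ∀ {a} {A : Set a} (xs : List A) (b : Carrier) (f : A → Carrier) →
         ∑ xs (λ x → b * f x) ≈ b * ∑ xs f
  ∑-*ˡ []       b f = sym (zeroʳ b)
  ∑-*ˡ (x ∷ xs) b f = trans (+-congˡ (∑-*ˡ xs b f)) (sym (distribˡ b (f x) (∑ xs f)))

  ∑-++ : ∀ {a} {A : Set a} (xs ys : List A) (f : A → Carrier) → ∑ (xs ++ ys) f ≈ ∑ xs f + ∑ ys f
  ∑-++ []       ys f = sym (+-identityˡ _)
  ∑-++ (x ∷ xs) ys f = trans (+-congˡ (∑-++ xs ys f)) (sym (+-assoc _ _ _))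

  ∑-map : ∀ {a b} {A : Set a} {B : Set b} (g : A → B) (xs : List A) (f : B → Carrier) →
          ∑ (map g xs) f ≈ ∑ xs (λ x → f (g x))
  ∑-map g []       f = refl
  ∑-map g (x ∷ xs) f = +-congˡ (∑-map g xs f)

  ∑-concatMap : ∀ {a b} {A : Set a} {B : Set b} (g : A → List B) (xs : List A) (f : B → Carrier) →
                ∑ (concatMap g xs) f ≈ ∑ xs (λ x → ∑ (g x) f)
  ∑-concatMap g []       f = refl
  ∑-concatMap g (x ∷ xs) f = trans (∑-++ (g x) (concatMap g xs) f) (+-congˡ (∑-concatMap g xs f))

module Reindexing {c ℓ : Level} (R : CommutativeRing c ℓ) where
  open CommutativeRing R
  open ListSums R
  open CommutativeSemigroupProperties +-commutativeSemigroup using (x∙yz≈y∙xz)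
  open SetoidMembership setoid using (_∈_)
  open SetoidMembershipProperties using (∈-resp-≈; All[≉]⇒∉)
  open SetoidUnique setoid using (Unique)

  Respecting : (Carrier → Carrier) → Set (c ⊔ ℓ)
  Respecting f = ∀ {x y} → x ≈ y → f x ≈ f y

  ∑-remove : ∀ xs {a} (a∈xs : a ∈ xs) (f : Carrier → Carrier) → Respecting f →
             ∑ xs f ≈ f a + ∑ (xs ─ a∈xs) f
  ∑-remove (y ∷ ys) (here a≈y)    f resp = +-congʳ (resp (sym a≈y))
  ∑-remove (y ∷ ys) {a} (there a∈ys) f resp =
    trans (+-congˡ (∑-remove ys a∈ys f resp)) (x∙yz≈y∙xz (f y) (f a) (∑ (ys ─ a∈ys) f))

  ∈-remove⁻ : ∀ xs {a} (a∈xs : a ∈ xs) {x} → x ∈ (xs ─ a∈xs) → x ∈ xs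
  ∈-remove⁻ (y ∷ ys) (here _)     x∈          = there x∈
  ∈-remove⁻ (y ∷ ys) (there a∈ys) (here x≈y)  = here x≈y
  ∈-remove⁻ (y ∷ ys) (there a∈ys) (there x∈)  = there (∈-remove⁻ ys a∈ys x∈)

  ∈-remove⁺ : ∀ xs {a} (a∈xs : a ∈ xs) {x} → x ∈ xs → ¬ (x ≈ a) → x ∈ (xs ─ a∈xs)
  ∈-remove⁺ (y ∷ ys) (here a≈y)   (here x≈y)   x≉a = ⊥-elim (x≉a (trans x≈y (sym a≈y)))
  ∈-remove⁺ (y ∷ ys) (here a≈y)   (there x∈ys) x≉a = x∈ys
  ∈-remove⁺ (y ∷ ys) (there a∈ys) (here x≈y)   x≉a = here x≈y
  ∈-remove⁺ (y ∷ ys) (there a∈ys) (there x∈ys) x≉a = there (∈-remove⁺ ys a∈ys x∈ys x≉a)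

  ∉-remove : ∀ xs {a} (a∈xs : a ∈ xs) → Unique xs → ∀ {x} → x ∈ (xs ─ a∈xs) → ¬ (x ≈ a)
  ∉-remove (y ∷ ys) (here a≈y)   (y∉ys ∷ _) x∈ys       x≈a =
    All[≉]⇒∉ setoid y∉ys (∈-resp-≈ setoid (trans x≈a a≈y) x∈ys)
  ∉-remove (y ∷ ys) (there a∈ys) (y∉ys ∷ _) (here x≈y) x≈a =
    All[≉]⇒∉ setoid y∉ys (∈-resp-≈ setoid (trans (sym x≈a) x≈y) a∈ys)
  ∉-remove (y ∷ ys) (there a∈ys) (_ ∷ uniq) (there x∈) = ∉-remove ys a∈ys uniq x∈

  unique-remove : ∀ xs {a} (a∈xs : a ∈ xs) → Unique xs → Unique (xs ─ a∈xs)
  unique-remove (y ∷ ys) (here _)     (_ ∷ uniq)    = uniq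
  unique-remove (y ∷ ys) (there a∈ys) (y∉ys ∷ uniq) = ─⁺ a∈ys y∉ys ∷ unique-remove ys a∈ys uniq

  ∑-same-members : ∀ xs ys → Unique xs → Unique ys →
                   (∀ {x} → x ∈ xs → x ∈ ys) → (∀ {x} → x ∈ ys → x ∈ xs) →
                   ∀ f → Respecting f → ∑ xs f ≈ ∑ ys f
  ∑-same-members []       []       _ _ _ _ f resp = refl
  ∑-same-members []       (y ∷ ys) _ _ _ ys⊆xs f resp with ys⊆xs (here refl)
  ... | ()
  ∑-same-members (a ∷ xs) ys (a∉xs ∷ uniqˣ) uniqʸ xs⊆ys ys⊆xs f resp =
    trans (+-congˡ (∑-same-members xs (ys ─ a∈ys) uniqˣ (unique-remove ys a∈ys uniqʸ) forth back f resp))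
          (sym (∑-remove ys a∈ys f resp))
    where
      a∈ys : a ∈ ys
      a∈ys = xs⊆ys (here refl)
      forth : ∀ {x} → x ∈ xs → x ∈ (ys ─ a∈ys)
      forth x∈xs = ∈-remove⁺ ys a∈ys (xs⊆ys (there x∈xs))
                     (λ x≈a → All[≉]⇒∉ setoid a∉xs (∈-resp-≈ setoid x≈a x∈xs))
      back : ∀ {x} → x ∈ (ys ─ a∈ys) → x ∈ xs
      back x∈ with ys⊆xs (∈-remove⁻ ys a∈ys x∈)
      ... | here x≈a   = ⊥-elim (∉-remove ys a∈ys uniqʸ x∈ x≈a)
      ... | there x∈xs = x∈xs

-- In a finite ring, enumerated without repetition by `elems`, the number of
-- elements is zero: Σ_{x} 1 = 0.  Indeed x ↦ x + 1 permutes the ring, so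
-- Σ_x x = Σ_x (x + 1) = Σ_x x + Σ_x 1.
module FiniteRing {c ℓ : Level} (R : CommutativeRing c ℓ) where
  open CommutativeRing R
  open ListSums R
  open Reindexing R
  open GroupProperties +-group using (∙-cancelˡ; ∙-cancelʳ; //-rightDividesˡ)
  open SetoidMembership setoid using (_∈_)
  open SetoidMembershipProperties using (∈-resp-≈; ∈-map⁺)
  open SetoidUnique setoid using (Unique)
  open SetoidUniqueProperties using () renaming (map⁺ to unique-map⁺)

  module _ (elems : List Carrier) (complete : ∀ x → x ∈ elems) (unique : Unique elems) where

    ∑-shift : ∑ elems (λ x → x + 1#) ≈ ∑ elems (λ x → x)
    ∑-shift = trans (sym (∑-map (_+ 1#) elems (λ x → x)))
                (∑-same-members shifted elems (unique-map⁺ setoid setoid (∙-cancelʳ 1# _ _) unique)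
                  unique (λ {x} _ → complete x) from-elems (λ x → x) (λ x≈y → x≈y))
      where
        shifted : List Carrier
        shifted = map (_+ 1#) elems
        from-elems : ∀ {x} → x ∈ elems → x ∈ shifted
        from-elems {x} _ = ∈-resp-≈ setoid (//-rightDividesˡ 1# x)
                             (∈-map⁺ setoid setoid +-congʳ (complete (x + - 1#)))

    ∑-one : ∑ elems (λ _ → 1#) ≈ 0#
    ∑-one = ∙-cancelˡ s _ _ (begin
      s + ∑ elems (λ _ → 1#)  ≈⟨ ∑-+ elems (λ x → x) (λ _ → 1#) ⟨
      ∑ elems (λ x → x + 1#)  ≈⟨ ∑-shift ⟩
      s                       ≈⟨ +-identityʳ s ⟨
      s + 0#                  ∎)
      where
        open SetoidReasoning setoid
        s : Carrier
        s = ∑ elems (λ x → x)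

    ∑-const : ∀ b → ∑ elems (λ _ → b) ≈ 0#
    ∑-const b = begin
      ∑ elems (λ _ → b)       ≈⟨ ∑-cong elems (λ _ → *-identityʳ b) ⟨
      ∑ elems (λ _ → b * 1#)  ≈⟨ ∑-*ˡ elems b (λ _ → 1#) ⟩
      b * ∑ elems (λ _ → 1#)  ≈⟨ *-congˡ ∑-one ⟩
      b * 0#                  ≈⟨ zeroʳ b ⟩
      0#                      ∎
      where open SetoidReasoning setoid

module PolynomialFunctions {c ℓ : Level} (R : CommutativeRing c ℓ) where
  open CommutativeRing R
  open CommutativeSemigroupProperties +-commutativeSemigroup using (interchange)
  open CommutativeSemigroupProperties *-commutativeSemigroup using (x∙yz≈y∙xz)
  open SetoidReasoning setoid

  data PolyFun : (e d : ℕ) → (Vec Carrier e → Carrier) → Set (c ⊔ ℓ) where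
    const  : ∀ {e} (a : Carrier) → PolyFun e 0 (λ _ → a)
    var    : ∀ {e} (i : Fin e) → PolyFun e 1 (λ v → lookup v i)
    add    : ∀ {e d f g} → PolyFun e d f → PolyFun e d g → PolyFun e d (λ v → f v + g v)
    mul    : ∀ {e d d′ f g} → PolyFun e d f → PolyFun e d′ g →
             PolyFun e (d ℕ.+ d′) (λ v → f v * g v)
    weaken : ∀ {e d d′ f} → d ≤ d′ → PolyFun e d f → PolyFun e d′ f
    resp   : ∀ {e d f g} → (∀ v → f v ≈ g v) → PolyFun e d f → PolyFun e d g

  zero-poly : ∀ {e} d → PolyFun e d (λ _ → 0#)
  zero-poly d = weaken z≤n (const 0#)

  fix-first : ∀ {e d f} → PolyFun (suc e) d f → ∀ x → PolyFun e d (λ w → f (x ∷ w))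
  fix-first (const a)       x = const a
  fix-first (var zero)      x = weaken z≤n (const x)
  fix-first (var (suc i))   x = var i
  fix-first (add P Q)       x = add (fix-first P x) (fix-first Q x)
  fix-first (mul P Q)       x = mul (fix-first P x) (fix-first Q x)
  fix-first (weaken d≤d′ P) x = weaken d≤d′ (fix-first P x)
  fix-first (resp f≈g P)    x = resp (λ w → f≈g (x ∷ w)) (fix-first P x)

  ignore-first : ∀ {e d g} → PolyFun e d g → PolyFun (suc e) d (λ v → g (tail v))
  ignore-first (const a)       = const a
  ignore-first (var i)         = resp (λ { (_ ∷ _) → refl }) (var (suc i))
  ignore-first (add P Q)       = add (ignore-first P) (ignore-first Q)
  ignore-first (mul P Q)       = mul (ignore-first P) (ignore-first Q)
  ignore-first (weaken d≤d′ P) = weaken d≤d′ (ignore-first P)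
  ignore-first (resp f≈g P)    = resp (λ v → f≈g (tail v)) (ignore-first P)

  PolyFun< : (e d : ℕ) → (Vec Carrier e → Carrier) → Set (c ⊔ ℓ)
  PolyFun< e zero    f = ∀ w → f w ≈ 0#
  PolyFun< e (suc d) f = PolyFun e d f

  <-weaken : ∀ {e d d′ f} → d ≤ d′ → PolyFun< e d f → PolyFun< e d′ f
  <-weaken {d′ = zero}   z≤n        f≈0 = f≈0
  <-weaken {d′ = suc d′} z≤n        f≈0 = resp (λ w → sym (f≈0 w)) (zero-poly d′)
  <-weaken               (s≤s d≤d′) P   = weaken d≤d′ P

  <-add : ∀ {e} d {f g} → PolyFun< e d f → PolyFun< e d g → PolyFun< e d (λ w → f w + g w)
  <-add zero    f≈0 g≈0 = λ w → trans (+-cong (f≈0 w) (g≈0 w)) (+-identityʳ 0#)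
  <-add (suc d) P   Q   = add P Q

  <-mulˡ : ∀ {e} d {d′ f g} → PolyFun< e d f → PolyFun e d′ g →
           PolyFun< e (d ℕ.+ d′) (λ w → f w * g w)
  <-mulˡ zero    f≈0 Q = <-weaken z≤n (λ w → trans (*-congʳ (f≈0 w)) (zeroˡ _))
  <-mulˡ (suc d) P   Q = mul P Q

  <-mulʳ : ∀ {e} d {d′ f g} → PolyFun e d f → PolyFun< e d′ g →
           PolyFun< e (d ℕ.+ d′) (λ w → f w * g w)
  <-mulʳ d {zero}   P g≈0 = <-weaken z≤n (λ w → trans (*-congˡ (g≈0 w)) (zeroʳ _))
  <-mulʳ {e} d {suc d′} {f} {g} P Q =
    ≡.subst (λ n → PolyFun< e n (λ w → f w * g w)) (≡.sym (ℕP.+-suc d d′)) (mul P Q)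

  record Split (e d : ℕ) (f : Vec Carrier (suc e) → Carrier) : Set (c ⊔ ℓ) where
    field
      g      : Vec Carrier e → Carrier
      h      : Carrier → Vec Carrier e → Carrier
      g-poly : PolyFun e d g
      h-poly : ∀ x → PolyFun< e d (h x)
      split-eq : ∀ x w → f (x ∷ w) ≈ g w + x * h x w

  split : ∀ {e d f} → PolyFun (suc e) d f → Split e d f
  split (const a) = record
    { g = λ _ → a ; h = λ _ _ → 0# ; g-poly = const a ; h-poly = λ _ _ → refl
    ; split-eq = λ x w → sym (trans (+-congˡ (zeroʳ x)) (+-identityʳ a)) }
  split (var zero) = record
    { g = λ _ → 0# ; h = λ _ _ → 1# ; g-poly = zero-poly 1 ; h-poly = λ _ → const 1#
    ; split-eq = λ x w → sym (trans (+-identityˡ _) (*-identityʳ x)) }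
  split (var (suc i)) = record
    { g = λ w → lookup w i ; h = λ _ _ → 0# ; g-poly = var i ; h-poly = λ _ → const 0#
    ; split-eq = λ x w → sym (trans (+-congˡ (zeroʳ x)) (+-identityʳ _)) }
  split {d = d} (add {f = f₁} {g = f₂} P Q) = record
    { g = λ w → g₁ w + g₂ w ; h = λ x w → h₁ x w + h₂ x w
    ; g-poly = add g₁-poly g₂-poly ; h-poly = λ x → <-add d (h₁-poly x) (h₂-poly x)
    ; split-eq = λ x w → begin
        f₁ (x ∷ w) + f₂ (x ∷ w)                    ≈⟨ +-cong (eq₁ x w) (eq₂ x w) ⟩
        (g₁ w + x * h₁ x w) + (g₂ w + x * h₂ x w)  ≈⟨ interchange _ _ _ _ ⟩
        (g₁ w + g₂ w) + (x * h₁ x w + x * h₂ x w)  ≈⟨ +-congˡ (distribˡ x _ _) ⟨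
        (g₁ w + g₂ w) + x * (h₁ x w + h₂ x w)      ∎ }
    where
      open Split (split P) renaming (g to g₁; h to h₁; g-poly to g₁-poly; h-poly to h₁-poly; split-eq to eq₁)
      open Split (split Q) renaming (g to g₂; h to h₂; g-poly to g₂-poly; h-poly to h₂-poly; split-eq to eq₂)
  split (mul {d = d₁} {f = f₁} {g = f₂} P Q) = record
    { g = λ w → g₁ w * g₂ w ; h = λ x w → g₁ w * h₂ x w + h₁ x w * f₂ (x ∷ w)
    ; g-poly = mul g₁-poly g₂-poly
    ; h-poly = λ x → <-add (d₁ ℕ.+ _) (<-mulʳ d₁ g₁-poly (h₂-poly x)) (<-mulˡ d₁ (h₁-poly x) (fix-first Q x))
    ; split-eq = product-eq }
    where
      open Split (split P) renaming (g to g₁; h to h₁; g-poly to g₁-poly; h-poly to h₁-poly; split-eq to eq₁)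
      open Split (split Q) renaming (g to g₂; h to h₂; g-poly to g₂-poly; h-poly to h₂-poly; split-eq to eq₂)
      product-eq : ∀ x w → f₁ (x ∷ w) * f₂ (x ∷ w) ≈
                           g₁ w * g₂ w + x * (g₁ w * h₂ x w + h₁ x w * f₂ (x ∷ w))
      product-eq x w = begin
        f₁ (x ∷ w) * v                                  ≈⟨ *-congʳ (eq₁ x w) ⟩
        (g₁ w + x * h₁ x w) * v                         ≈⟨ distribʳ v _ _ ⟩
        g₁ w * v + (x * h₁ x w) * v                     ≈⟨ +-congʳ (*-congˡ (eq₂ x w)) ⟩
        g₁ w * (g₂ w + x * h₂ x w) + (x * h₁ x w) * v   ≈⟨ +-cong (distribˡ (g₁ w) _ _) (*-assoc x _ v) ⟩
        (g₁ w * g₂ w + g₁ w * (x * h₂ x w)) + x * (h₁ x w * v)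
                                                        ≈⟨ +-congʳ (+-congˡ (x∙yz≈y∙xz (g₁ w) x _)) ⟩
        (g₁ w * g₂ w + x * (g₁ w * h₂ x w)) + x * (h₁ x w * v)
                                                        ≈⟨ +-assoc _ _ _ ⟩
        g₁ w * g₂ w + (x * (g₁ w * h₂ x w) + x * (h₁ x w * v))
                                                        ≈⟨ +-congˡ (distribˡ x _ _) ⟨
        g₁ w * g₂ w + x * (g₁ w * h₂ x w + h₁ x w * v)  ∎
        where
          v : Carrier
          v = f₂ (x ∷ w)
  split (weaken d≤d′ P) = record
    { g = g ; h = h ; g-poly = weaken d≤d′ g-poly ; h-poly = λ x → <-weaken d≤d′ (h-poly x)
    ; split-eq = split-eq }
    where open Split (split P)
  split (resp f≈f′ P) = record
    { g = g ; h = h ; g-poly = g-poly ; h-poly = h-poly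
    ; split-eq = λ x w → trans (sym (f≈f′ (x ∷ w))) (split-eq x w) }
    where open Split (split P)

-- Induction on e: split f(x ∷ w) = g w + x · h x w; the
-- inner sums of h x vanish by induction, and what remains is the constant
-- Σ_w g w summed over all x ∈ F, which is 0 (only the finiteness of the ring
-- is used, not that F is a field).
module Vanishing {c ℓ : Level} {p m0 : ℕ} (F : FiniteField c ℓ p m0) where
  open FiniteField F hiding (zero)
  open ListSums baseRing
  open FiniteRing baseRing using (∑-const)
  open PolynomialFunctions baseRing
  open SetoidReasoning setoid

  ∑-allVecs-suc : ∀ e (f : Vec Carrier (suc e) → Carrier) →
                  ∑ (allVecs (suc e)) f ≈ ∑ elems (λ x → ∑ (allVecs e) (λ w → f (x ∷ w)))
  ∑-allVecs-suc e f = trans (∑-concatMap (λ x → map (x ∷_) (allVecs e)) elems f)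
                            (∑-cong elems (λ x → ∑-map (x ∷_) (allVecs e) f))

  mutual
    ∑-vanishes : ∀ e {d f} → PolyFun e d f → d < e → ∑ (allVecs e) f ≈ 0#
    ∑-vanishes zero    P ()
    ∑-vanishes (suc e) {d} {f} P (s≤s d≤e) = begin
      ∑ (allVecs (suc e)) f                            ≈⟨ ∑-allVecs-suc e f ⟩
      ∑ elems (λ x → ∑ (allVecs e) (λ w → f (x ∷ w)))  ≈⟨ ∑-cong elems fibre-sum ⟩
      ∑ elems (λ _ → ∑ (allVecs e) g)                  ≈⟨ ∑-const elems complete unique _ ⟩
      0#                                               ∎
      where
        open Split (split P)
        fibre-sum : ∀ x → ∑ (allVecs e) (λ w → f (x ∷ w)) ≈ ∑ (allVecs e) g
        fibre-sum x = begin
          ∑ (allVecs e) (λ w → f (x ∷ w))                          ≈⟨ ∑-cong (allVecs e) (split-eq x) ⟩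
          ∑ (allVecs e) (λ w → g w + x * h x w)                    ≈⟨ ∑-+ (allVecs e) g (λ w → x * h x w) ⟩
          ∑ (allVecs e) g + ∑ (allVecs e) (λ w → x * h x w)        ≈⟨ +-congˡ (∑-*ˡ (allVecs e) x (h x)) ⟩
          ∑ (allVecs e) g + x * ∑ (allVecs e) (h x)                ≈⟨ +-congˡ (*-congˡ (∑-vanishes< e d (h-poly x) d≤e)) ⟩
          ∑ (allVecs e) g + x * 0#                                 ≈⟨ +-congˡ (zeroʳ x) ⟩
          ∑ (allVecs e) g + 0#                                     ≈⟨ +-identityʳ _ ⟩
          ∑ (allVecs e) g                                          ∎

    ∑-vanishes< : ∀ e d {f} → PolyFun< e d f → d ≤ e → ∑ (allVecs e) f ≈ 0#
    ∑-vanishes< e zero    f≈0 _   = ∑-zero (allVecs e) f≈0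
    ∑-vanishes< e (suc d) P   d<e = ∑-vanishes e P d<e

module PowerSums {c ℓ : Level} {p m0 : ℕ} (F : FiniteField c ℓ p m0) where
  open FiniteField F hiding (zero)
  open ListSums baseRing
  open PolynomialFunctions baseRing
  open Vanishing F using (∑-vanishes)

  CoeffPoly : (e d : ℕ) → (Vec Carrier e → Poly2) → Set (c ⊔ ℓ)
  CoeffPoly e d T = ∀ i k → PolyFun e d (λ v → T v i k)

  sumTo-poly : ∀ {e d} n (H : ℕ → Vec Carrier e → Carrier) → (∀ a → PolyFun e d (H a)) →
               PolyFun e d (λ v → sumTo n (λ a → H a v))
  sumTo-poly zero    H P = P 0
  sumTo-poly (suc n) H P = add (sumTo-poly n H P) (P (suc n))

  *P-coeffPoly : ∀ {e d₁ d₂ T U} → CoeffPoly e d₁ T → CoeffPoly e d₂ U →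
                 CoeffPoly e (d₁ ℕ.+ d₂) (λ v → T v *P U v)
  *P-coeffPoly {T = T} {U} PT PU i k =
    sumTo-poly i (λ a v → sumTo k (λ b → T v a b * U v (i ∸ a) (k ∸ b))) λ a →
      sumTo-poly k (λ b v → T v a b * U v (i ∸ a) (k ∸ b)) λ b →
        mul (PT a b) (PU (i ∸ a) (k ∸ b))

  oneP-coeffPoly : ∀ {e} → CoeffPoly e 0 (λ _ → oneP)
  oneP-coeffPoly zero    zero    = const 1#
  oneP-coeffPoly zero    (suc k) = const 0#
  oneP-coeffPoly (suc i) k       = const 0#

  ^P-coeffPoly : ∀ {e d T} → CoeffPoly e d T → ∀ n → CoeffPoly e (n ℕ.* d) (λ v → T v ^P n)
  ^P-coeffPoly PT zero    = oneP-coeffPoly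
  ^P-coeffPoly PT (suc n) = *P-coeffPoly PT (^P-coeffPoly PT n)

  monicCoeff-poly : ∀ e k → PolyFun e 1 (λ v → monicCoeff v k)
  monicCoeff-poly zero    zero    = resp (λ { [] → refl }) (weaken z≤n (const 1#))
  monicCoeff-poly zero    (suc k) = resp (λ { [] → refl }) (zero-poly 1)
  monicCoeff-poly (suc e) zero    = resp (λ { (_ ∷ _) → refl }) (var zero)
  monicCoeff-poly (suc e) (suc k) = resp (λ { (_ ∷ _) → refl }) (ignore-first (monicCoeff-poly e k))

  χt-coeffPoly : ∀ {e} → CoeffPoly e 1 χt
  χt-coeffPoly {e} zero    k = monicCoeff-poly e k
  χt-coeffPoly     (suc i) k = zero-poly 1

  inθ-coeffPoly : ∀ {e} → CoeffPoly e 1 inθ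
  inθ-coeffPoly {e} i zero    = monicCoeff-poly e i
  inθ-coeffPoly     i (suc k) = zero-poly 1

  foldr-+P-coeff : ∀ {a} {A : Set a} (T : A → Poly2) (xs : List A) i k →
                   foldr (λ x acc → T x +P acc) zeroP xs i k ≈ ∑ xs (λ x → T x i k)
  foldr-+P-coeff T []       i k = refl
  foldr-+P-coeff T (x ∷ xs) i k = +-congˡ (foldr-+P-coeff T xs i k)

  S-vanishes : ∀ β j e → β ℕ.+ j < e → IsZero (S β j e)
  S-vanishes β j e β+j<e i k =
    trans (foldr-+P-coeff (λ v → (χt v ^P β) *P (inθ v ^P j)) (allVecs e) i k)
          (∑-vanishes e (weaken degree-bound (term-poly i k)) β+j<e)
    where
      term-poly : CoeffPoly e (β ℕ.* 1 ℕ.+ j ℕ.* 1) (λ v → (χt v ^P β) *P (inθ v ^P j))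
      term-poly = *P-coeffPoly (^P-coeffPoly χt-coeffPoly β) (^P-coeffPoly inθ-coeffPoly j)
      degree-bound : β ℕ.* 1 ℕ.+ j ℕ.* 1 ≤ β ℕ.+ j
      degree-bound = ℕP.≤-reflexive (≡.cong₂ ℕ._+_ (ℕP.*-identityʳ β) (ℕP.*-identityʳ j))

-- Theorem 5.2: for e > β + j the coefficient Σ_{a ∈ A_+(e)} χ_t(a)^β a^j of
-- x^(-e) in z(χ_t^β, x, -j) vanishes, so z(χ_t^β, x, -j) ∈ A[t][x⁻¹].
theorem5p2 : ∀ {c ℓ : Level} {p m0 : ℕ} (F : FiniteField c ℓ p m0) (β j : ℕ) →
    ∃ λ N → ∀ e → e ≥ N → FiniteField.IsZero F (FiniteField.S F β j e)
theorem5p2 F β j = suc (β ℕ.+ j) , PowerSums.S-vanishes F β j
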